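{- Let $G$ be a finite abelian group, $\mathcal{E}\subset G$ a subgroup of index $2$, $\mathcal{O}=G\setminus\mathcal{E}$, and fix $u\in\mathcal{O}$. For each nonempty $Z\subset\mathcal{E}$ let $g(Z)$ be a chosen maximum-size cover-maximal subset of $Z$. Then for each $Z\subset\mathcal{E}$, there are at most $12^{|Z|}$ sets $Z'\subset\mathcal{E}$ such that $g(Z')=Z$.
   Context: For $z\in\mathcal{E}$, $\mathcal{G}_z$ is the graph with vertex set $\mathcal{O}$ and edges $\{a,b\}$, $a\neq b$, with $a+b=z$ or $a-b=z$. A set $Z\subset\mathcal{E}$ is covered by $Y\subset\mathcal{O}$ if for each $z\in Z$ there is $y\in Y$ with $\{u,y\}\in E(\mathcal{G}_z)$. $Z$ is cover-maximal if $|Y|\geqslant|Z|$ for every $Y\subset\mathcal{O}$ that covers $Z$. (Every singleton is cover-maximal, so $g(Z)$ is nonempty.) -}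

module Defs where

open import Data.Nat using (ℕ; _≤_; _*_)
open import Data.Fin using (Fin)
open import Data.Fin.Subset using (Subset; _∈_; _∉_; _⊆_; ∣_∣; Nonempty)
open import Data.Product using (Σ; _×_; ∃-syntax)
open import Data.Sum using (_⊎_)
open import Relation.Binary.PropositionalEquality using (_≡_; _≢_)
open import Algebra.Structures using (IsAbelianGroup)

-- A finite abelian group of order n is represented with carrier Fin n
-- (every finite abelian group is isomorphic to one of this form).
-- Everything below is parametrised by the group operations.
module _ {n : ℕ} (_+_ : Fin n → Fin n → Fin n) (ε : Fin n) (-_ : Fin n → Fin n) where

  _−_ : Fin n → Fin n → Fin n
  a − b = a + (- b)

  IsSubgroup : Subset n → Set
  IsSubgroup E = (ε ∈ E)
               × (∀ {a b} → a ∈ E → b ∈ E → (a + b) ∈ E)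
               × (∀ {a} → a ∈ E → (- a) ∈ E)

  -- index 2 (for a finite group: |G| = 2 |E|)
  HasIndex2 : Subset n → Set
  HasIndex2 E = ∣ E ∣ * 2 ≡ n

  -- {a,b} is an edge of the graph G_z : a ≠ b and a + b = z or a − b = z
  -- (the edge is unordered, so also b − a = z).  Vertices lie in O.
  Edge : (O : Subset n) → (z a b : Fin n) → Set
  Edge O z a b = a ∈ O × b ∈ O × a ≢ b
               × ((a + b ≡ z) ⊎ (a − b ≡ z) ⊎ (b − a ≡ z))

  Covers : (O : Subset n) (u : Fin n) → (Y Z : Subset n) → Set
  Covers O u Y Z = ∀ {z} → z ∈ Z → ∃[ y ] (y ∈ Y × Edge O z u y)

  CoverMaximal : (O : Subset n) (u : Fin n) → Subset n → Set
  CoverMaximal O u Z = ∀ (Y : Subset n) → Y ⊆ O → Covers O u Y Z → ∣ Z ∣ ≤ ∣ Y ∣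

  IsMaxCoverMaximalSubset : (O : Subset n) (u : Fin n) → (Z W : Subset n) → Set
  IsMaxCoverMaximalSubset O u Z W =
    W ⊆ Z × CoverMaximal O u W
    × (∀ (V : Subset n) → V ⊆ Z → CoverMaximal O u V → ∣ V ∣ ≤ ∣ W ∣)

module Submission where

open import Defs using (Edge; Covers; CoverMaximal; IsMaxCoverMaximalSubset; IsSubgroup; HasIndex2)
open import Data.Nat using (ℕ; zero; suc; _+_; _*_; _^_; _≤_; _<_; z≤n; s≤s)
open import Data.Nat.Properties
  using (≤-refl; ≤-reflexive; ≤-trans; +-monoʳ-≤; +-suc; +-comm; *-mono-≤; *-mono-<; <⇒≱; ≰⇒>; _≤?_; n≤1+n;
         *-commutativeSemigroup; module ≤-Reasoning)
open import Algebra.Properties.CommutativeSemigroup *-commutativeSemigroup using (interchange)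
open import Algebra.Bundles using (AbelianGroup)
open import Algebra.Structures using (IsAbelianGroup)
open import Data.Bool using (Bool; true; false; T; _∧_)
open import Data.Bool.Properties using () renaming (_≟_ to _≟ᵇ_)
open import Data.Fin using (Fin; zero; suc; Fin′; inject)
open import Data.Fin.Patterns using (0F; 1F; 2F; 3F)
open import Data.Fin.Properties using (_≟_; any?; all?; ¬∀⟶∃¬; ¬∀⟶∃¬-smallest)
open import Data.Fin.Subset
  using (Subset; inside; outside; _∈_; _∉_; _⊆_; _∪_; _─_; ⁅_⁆; ∣_∣; ∁; Nonempty)
open import Data.Fin.Subset.Properties
  using (_∈?_; x∈p∪q⁺; x∈p∪q⁻; x∈⁅x⁆; x∈⁅y⁆⇒x≡y; p⊆p∪q; p─q⊆p; p⊆q⇒∣p∣≤∣q∣; p⊂q⇒∣p∣<∣q∣;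
         ∣⁅x⁆∣≡1; ∣p∣≤∣x∷p∣; x∈p∧x≢y⇒x∈p-y; x∈p⇒∣p-x∣<∣p∣; x∉p⇒x∈∁p; x∈∁p⇒x∉p; ⊆-antisym)
open import Data.Vec using ([]; _∷_; here; there)
open import Data.Maybe using (Maybe; just; nothing)
open import Data.Maybe.Properties using (just-injective) renaming (≡-dec to ≡-decₘ)
open import Data.List
  using (List; []; _∷_; [_]; _++_; length; map; filter; cartesianProduct; cartesianProductWith)
open import Data.List.Properties using (length-++; length-map; length-removeAt′; ∷-injective; length-filter)
open import Data.List.Relation.Unary.All as All using (All)
open import Data.List.Relation.Unary.Any using (here; there; index) renaming (_─_ to _∖_)
open import Data.List.Relation.Unary.AllPairs using (_∷_)
open import Data.List.Relation.Unary.Unique.Propositional using (Unique)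
open import Data.List.Relation.Unary.Unique.Propositional.Properties using (Unique[x∷xs]⇒x∉xs; cartesianProduct⁺)
open import Data.List.Membership.Propositional using () renaming (_∈_ to _∈ₗ_)
open import Data.List.Membership.Propositional.Properties
  using (∈-map⁺; ∈-map⁻; ∈-filter⁺; ∈-cartesianProductWith⁺; ∈-cartesianProduct⁺; ∈-cartesianProduct⁻)
open import Data.Product using (_×_; _,_; proj₁; proj₂; ∃-syntax)
open import Data.Sum using (_⊎_; inj₁; inj₂)
open import Function using (_∘_)
open import Relation.Binary.PropositionalEquality
  using (_≡_; _≢_; refl; sym; trans; cong; cong₂; subst; subst₂; module ≡-Reasoning)
open import Relation.Nullary using (¬_; Dec; does; yes; no; ¬?; _×-dec_; _→-dec_; contradiction)
open import Relation.Nullary.Decidable using (T?; dec-true; dec-false; decidable-stable)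
open import Relation.Unary using (Decidable)

-- Call Z′ a preimage of Z when Z is a maximum-size cover-maximal subset of Z′.
-- For x ∈ G, the candidates of x are -x, w - x, x + w and x - w (w = u + u):
-- two distinct elements sharing a u-neighbour are always candidates of each
-- other (Conflicts).  Two general exchange arguments on cover-maximal sets
-- (CoverMaximality) then constrain any preimage Z′:
--   * every x ∈ Z′ outside Z has a candidate in Z (candidate-in-Z);
--   * if a = -z and d = z - w both have z as their only candidate in Z, then
--     Z′ does not contain both (no-exclusive-pair).
-- We encode a *pair* of preimages: each x ∉ Z with a candidate in Z occupies a
-- slot of its candidates in Z, and stores its bit for the first preimage at
-- its primary candidate and its bit for the second one at a further candidate
-- (or also at the primary one if there is none).  A member z of Z then carries
-- at most 9 · 4 · 4 = 144 local codes, the 9 coming from no-exclusive-pair,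
-- and the code determines the pair.  Hence (number of preimages)² ≤ 144 ^ |Z|.

private
  variable
    A B C : Set

does-true⇒ : ∀ {P : Set} (p? : Dec P) → does p? ≡ true → P
does-true⇒ (yes p) _ = p

does-false⇒ : ∀ {P : Set} (p? : Dec P) → does p? ≡ false → ¬ P
does-false⇒ (no ¬p) _ = ¬p

module Counting where

  ∈-∖ : ∀ {x y : A} (ys : List A) (x∈ys : x ∈ₗ ys) → y ∈ₗ ys → y ≢ x → y ∈ₗ (ys ∖ x∈ys)
  ∈-∖ (_ ∷ _)  (here refl) (here refl) y≢x = contradiction refl y≢x
  ∈-∖ (_ ∷ _)  (here refl) (there y∈ys) _  = y∈ys
  ∈-∖ (_ ∷ _)  (there _)   (here y≡)    _  = here y≡
  ∈-∖ (_ ∷ ys) (there x∈ys) (there y∈ys) y≢x = there (∈-∖ ys x∈ys y∈ys y≢x)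

  injective-encoding : (f : A → B) {xs : List A} {ys : List B} → Unique xs
    → (∀ {x} → x ∈ₗ xs → f x ∈ₗ ys)
    → (∀ {x x′} → x ∈ₗ xs → x′ ∈ₗ xs → f x ≡ f x′ → x ≡ x′)
    → length xs ≤ length ys
  injective-encoding f {[]} _ _ _ = z≤n
  injective-encoding f {x ∷ xs} {ys} uniq@(_ ∷ uniq′) f∈ inj = begin
    suc (length xs)           ≤⟨ s≤s (injective-encoding f uniq′ f∈′ inj′) ⟩
    suc (length (ys ∖ fx∈ys)) ≡⟨ length-removeAt′ ys (index fx∈ys) ⟨
    length ys                 ∎
    where
    open ≤-Reasoning
    fx∈ys : f x ∈ₗ ys
    fx∈ys = f∈ (here refl)
    f∈′ : ∀ {x′} → x′ ∈ₗ xs → f x′ ∈ₗ (ys ∖ fx∈ys)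
    f∈′ x′∈xs = ∈-∖ ys fx∈ys (f∈ (there x′∈xs))
      (λ eq → Unique[x∷xs]⇒x∉xs uniq (subst (_∈ₗ xs) (inj (there x′∈xs) (here refl) eq) x′∈xs))
    inj′ : ∀ {x₁ x₂} → x₁ ∈ₗ xs → x₂ ∈ₗ xs → f x₁ ≡ f x₂ → x₁ ≡ x₂
    inj′ p q = inj (there p) (there q)

  length-cartesianProductWith : ∀ (g : A → B → C) xs ys →
    length (cartesianProductWith g xs ys) ≡ length xs * length ys
  length-cartesianProductWith g []       ys = refl
  length-cartesianProductWith g (x ∷ xs) ys = begin
    length (map (g x) ys ++ cartesianProductWith g xs ys)
      ≡⟨ length-++ (map (g x) ys) ⟩
    length (map (g x) ys) + length (cartesianProductWith g xs ys)
      ≡⟨ cong₂ _+_ (length-map (g x) ys) (length-cartesianProductWith g xs ys) ⟩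
    length ys + length xs * length ys ∎
    where open ≡-Reasoning

  length-cartesianProduct : ∀ (xs : List A) (ys : List B) →
    length (cartesianProduct xs ys) ≡ length xs * length ys
  length-cartesianProduct = length-cartesianProductWith _,_

  length-cartesianProduct-≤ : ∀ {a b} (xs : List A) (ys : List B) →
    length xs ≤ a → length ys ≤ b → length (cartesianProduct xs ys) ≤ a * b
  length-cartesianProduct-≤ xs ys xs≤a ys≤b =
    subst (_≤ _) (sym (length-cartesianProduct xs ys)) (*-mono-≤ xs≤a ys≤b)

  choices : List (List A) → List (List A)
  choices []         = [ [] ]
  choices (xs ∷ xss) = cartesianProductWith _∷_ xs (choices xss)

  map-∈-choices : ∀ (f : A → B) (options : A → List B) (zs : List A) →
    (∀ {z} → z ∈ₗ zs → f z ∈ₗ options z) → map f zs ∈ₗ choices (map options zs)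
  map-∈-choices f options []       _   = here refl
  map-∈-choices f options (z ∷ zs) f∈ =
    ∈-cartesianProductWith⁺ _∷_ (f∈ (here refl)) (map-∈-choices f options zs (f∈ ∘ there))

  length-choices-≤ : ∀ {b} (options : A → List B) (zs : List A) →
    (∀ {z} → z ∈ₗ zs → length (options z) ≤ b) → length (choices (map options zs)) ≤ b ^ length zs
  length-choices-≤ options []       _ = ≤-refl
  length-choices-≤ {b = b} options (z ∷ zs) bounded = begin
    length (cartesianProductWith _∷_ (options z) (choices (map options zs)))
      ≡⟨ length-cartesianProductWith _∷_ (options z) _ ⟩
    length (options z) * length (choices (map options zs))
      ≤⟨ *-mono-≤ (bounded (here refl)) (length-choices-≤ options zs (λ p → bounded (there p))) ⟩
    b * b ^ length zs ∎
    where open ≤-Reasoning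

  map-≡⇒≡ : ∀ (f g : A → B) {z} zs → map f zs ≡ map g zs → z ∈ₗ zs → f z ≡ g z
  map-≡⇒≡ f g (_ ∷ _)  eq (here refl) = proj₁ (∷-injective eq)
  map-≡⇒≡ f g (_ ∷ zs) eq (there z∈zs) = map-≡⇒≡ f g zs (proj₂ (∷-injective eq)) z∈zs

module Squares where

  square-≤-cancel : ∀ {m n} → m * m ≤ n * n → m ≤ n
  square-≤-cancel {m} {n} m²≤n² with m ≤? n
  ... | yes m≤n = m≤n
  ... | no  m≰n = contradiction m²≤n² (<⇒≱ (*-mono-< n<m n<m))
    where
    n<m : n < m
    n<m = ≰⇒> m≰n

  ^-square : ∀ m k → (m * m) ^ k ≡ m ^ k * m ^ k
  ^-square m zero    = refl
  ^-square m (suc k) = begin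
    (m * m) * (m * m) ^ k       ≡⟨ cong ((m * m) *_) (^-square m k) ⟩
    (m * m) * (m ^ k * m ^ k)   ≡⟨ interchange m m (m ^ k) (m ^ k) ⟩
    (m * m ^ k) * (m * m ^ k)   ∎
    where open ≡-Reasoning

module Subsets where

  elements : ∀ {m} → Subset m → List (Fin m)
  elements []            = []
  elements (inside  ∷ p) = zero ∷ map suc (elements p)
  elements (outside ∷ p) = map suc (elements p)

  length-elements : ∀ {m} (p : Subset m) → length (elements p) ≡ ∣ p ∣
  length-elements []            = refl
  length-elements (inside  ∷ p) = cong suc (trans (length-map suc (elements p)) (length-elements p))
  length-elements (outside ∷ p) = trans (length-map suc (elements p)) (length-elements p)

  ∈-elements⁺ : ∀ {m} {x : Fin m} (p : Subset m) → x ∈ p → x ∈ₗ elements p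
  ∈-elements⁺ (inside  ∷ p) here        = here refl
  ∈-elements⁺ (inside  ∷ p) (there x∈p) = there (∈-map⁺ suc (∈-elements⁺ p x∈p))
  ∈-elements⁺ (outside ∷ p) (there x∈p) = ∈-map⁺ suc (∈-elements⁺ p x∈p)

  ∈-elements⁻ : ∀ {m} {x : Fin m} (p : Subset m) → x ∈ₗ elements p → x ∈ p
  ∈-elements⁻ (inside  ∷ p) (here refl) = here
  ∈-elements⁻ (inside  ∷ p) (there x∈)  with ∈-map⁻ suc x∈
  ... | _ , y∈ , refl = there (∈-elements⁻ p y∈)
  ∈-elements⁻ (outside ∷ p) x∈          with ∈-map⁻ suc x∈
  ... | _ , y∈ , refl = there (∈-elements⁻ p y∈)

  ∣p∪q∣≤∣p∣+∣q∣ : ∀ {m} (p q : Subset m) → ∣ p ∪ q ∣ ≤ ∣ p ∣ + ∣ q ∣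
  ∣p∪q∣≤∣p∣+∣q∣ []            []            = z≤n
  ∣p∪q∣≤∣p∣+∣q∣ (inside  ∷ p) (s ∷ q)       =
    s≤s (≤-trans (∣p∪q∣≤∣p∣+∣q∣ p q) (+-monoʳ-≤ ∣ p ∣ (∣p∣≤∣x∷p∣ s q)))
  ∣p∪q∣≤∣p∣+∣q∣ (outside ∷ p) (inside  ∷ q) =
    subst (suc ∣ p ∪ q ∣ ≤_) (sym (+-suc ∣ p ∣ ∣ q ∣)) (s≤s (∣p∪q∣≤∣p∣+∣q∣ p q))
  ∣p∪q∣≤∣p∣+∣q∣ (outside ∷ p) (outside ∷ q) = ∣p∪q∣≤∣p∣+∣q∣ p q

  ∣p∪⁅x⁆∣≤1+∣p∣ : ∀ {m} (p : Subset m) (x : Fin m) → ∣ p ∪ ⁅ x ⁆ ∣ ≤ suc ∣ p ∣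
  ∣p∪⁅x⁆∣≤1+∣p∣ p x = begin
    ∣ p ∪ ⁅ x ⁆ ∣       ≤⟨ ∣p∪q∣≤∣p∣+∣q∣ p ⁅ x ⁆ ⟩
    ∣ p ∣ + ∣ ⁅ x ⁆ ∣   ≡⟨ cong (∣ p ∣ +_) (∣⁅x⁆∣≡1 x) ⟩
    ∣ p ∣ + 1           ≡⟨ +-comm ∣ p ∣ 1 ⟩
    suc ∣ p ∣           ∎
    where open ≤-Reasoning

  ∣p∣<∣p∪⁅x⁆∣ : ∀ {m} {p : Subset m} {x : Fin m} → x ∉ p → ∣ p ∣ < ∣ p ∪ ⁅ x ⁆ ∣
  ∣p∣<∣p∪⁅x⁆∣ {x = x} x∉p = p⊂q⇒∣p∣<∣q∣ (p⊆p∪q ⁅ x ⁆ , x , x∈p∪q⁺ (inj₂ (x∈⁅x⁆ x)) , x∉p)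

  ∣p∣≤1+∣p-x∣ : ∀ {m} (p : Subset m) (x : Fin m) → ∣ p ∣ ≤ suc ∣ p ─ ⁅ x ⁆ ∣
  ∣p∣≤1+∣p-x∣ p x = ≤-trans (p⊆q⇒∣p∣≤∣q∣ p⊆p-x∪x) (∣p∪⁅x⁆∣≤1+∣p∣ (p ─ ⁅ x ⁆) x)
    where
    p⊆p-x∪x : p ⊆ (p ─ ⁅ x ⁆) ∪ ⁅ x ⁆
    p⊆p-x∪x {y} y∈p with y ≟ x
    ... | yes refl = x∈p∪q⁺ (inj₂ (x∈⁅x⁆ x))
    ... | no  y≢x  = x∈p∪q⁺ (inj₁ (x∈p∧x≢y⇒x∈p-y y∈p y≢x))

  ∪⁅⁆-⊆ : ∀ {m} {p q : Subset m} {x} → p ⊆ q → x ∈ q → p ∪ ⁅ x ⁆ ⊆ q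
  ∪⁅⁆-⊆ {p = p} {x = x} p⊆q x∈q y∈ with x∈p∪q⁻ p ⁅ x ⁆ y∈
  ... | inj₁ y∈p   = p⊆q y∈p
  ... | inj₂ y∈⁅x⁆ = subst (_∈ _) (sym (x∈⁅y⁆⇒x≡y x y∈⁅x⁆)) x∈q

module Identities {A : Set} {_+_ : A → A → A} {ε : A} { -_ : A → A}
                  (isAbelianGroup : IsAbelianGroup _≡_ _+_ ε -_) where

  open IsAbelianGroup isAbelianGroup using (assoc; comm)

  private
    abelianGroup : AbelianGroup _ _
    abelianGroup = record { isAbelianGroup = isAbelianGroup }

  open import Algebra.Properties.AbelianGroup abelianGroup public
    using (⁻¹-involutive; ⁻¹-anti-homo‿-; xyx⁻¹≈y; ε⁻¹≈ε; identityˡ-unique; ∙-cancelʳ)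
    renaming (//-rightDividesˡ to −-+-cancel; //-rightDividesʳ to +-−-cancel)

  infixl 6 _−_
  _−_ : A → A → A
  a − b = a + (- b)

  sub-sub : ∀ a b → b − (b − a) ≡ a
  sub-sub a b = begin
    b + (- (b − a))   ≡⟨ cong (b +_) (⁻¹-anti-homo‿- b a) ⟩
    b + (a − b)       ≡⟨ comm b (a − b) ⟩
    (a − b) + b       ≡⟨ −-+-cancel b a ⟩
    a                 ∎
    where open ≡-Reasoning

  sub-sum : ∀ a b → b − (a + b) ≡ - a
  sub-sum a b = begin
    b − (a + b)          ≡⟨ ⁻¹-anti-homo‿- (a + b) b ⟨
    - ((a + b) − b)      ≡⟨ cong -_ (+-−-cancel b a) ⟩
    - a                  ∎
    where open ≡-Reasoning

  sub-neg : ∀ a b → b − (- a) ≡ a + b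
  sub-neg a b = trans (cong (b +_) (⁻¹-involutive a)) (comm b a)

  sub-add-double : ∀ a b → (b − a) + (a + a) ≡ a + b
  sub-add-double a b = begin
    (b − a) + (a + a)    ≡⟨ assoc (b − a) a a ⟨
    ((b − a) + a) + a    ≡⟨ cong (_+ a) (−-+-cancel a b) ⟩
    b + a                ≡⟨ comm b a ⟩
    a + b                ∎
    where open ≡-Reasoning

module CoverMaximality {n : ℕ} (_+_ : Fin n → Fin n → Fin n) (ε : Fin n) (-_ : Fin n → Fin n)
                       (O : Subset n) (u : Fin n) where

  open Subsets

  private
    Edgeᵤ : Fin n → Fin n → Set
    Edgeᵤ z y = Edge _+_ ε -_ O z u y
    Coversᵤ : Subset n → Subset n → Set
    Coversᵤ = Covers _+_ ε -_ O u
    CoverMaximalᵤ : Subset n → Set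
    CoverMaximalᵤ = CoverMaximal _+_ ε -_ O u

  Clash : Fin n → Fin n → Set
  Clash x z = ∃[ y ] (Edgeᵤ x y × Edgeᵤ z y)

  -- A cover-maximal set stays cover-maximal when extended by an element that
  -- clashes with none of its members: covering x then costs a vertex of its own.
  insert-coverMaximal : ∀ {Z x} → CoverMaximalᵤ Z → (∀ {z} → z ∈ Z → ¬ Clash x z) →
                        CoverMaximalᵤ (Z ∪ ⁅ x ⁆)
  insert-coverMaximal {Z} {x} maximal noClash Y Y⊆O covers
    with covers (x∈p∪q⁺ (inj₂ (x∈⁅x⁆ x)))
  ... | yₓ , yₓ∈Y , edgeₓ = begin
    ∣ Z ∪ ⁅ x ⁆ ∣        ≤⟨ ∣p∪⁅x⁆∣≤1+∣p∣ Z x ⟩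
    suc ∣ Z ∣             ≤⟨ s≤s (maximal (Y ─ ⁅ yₓ ⁆) (λ y∈ → Y⊆O (p─q⊆p Y _ y∈)) coversZ) ⟩
    suc ∣ Y ─ ⁅ yₓ ⁆ ∣    ≤⟨ x∈p⇒∣p-x∣<∣p∣ yₓ∈Y ⟩
    ∣ Y ∣                 ∎
    where
    open ≤-Reasoning
    coversZ : Coversᵤ (Y ─ ⁅ yₓ ⁆) Z
    coversZ z∈Z with covers (x∈p∪q⁺ (inj₁ z∈Z))
    ... | y , y∈Y , edge = y , x∈p∧x≢y⇒x∈p-y y∈Y (λ { refl → noClash z∈Z (y , edgeₓ , edge) }) , edge

  -- The vertices covering a and d are then replaced by y₀ alone.
  exchange-coverMaximal : ∀ {Z z y₀ a d} → CoverMaximalᵤ Z → z ∈ Z → Edgeᵤ z y₀ → ¬ Clash a d →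
    (∀ {z′} → z′ ∈ Z → z′ ≢ z → ¬ Clash a z′) → (∀ {z′} → z′ ∈ Z → z′ ≢ z → ¬ Clash d z′) →
    CoverMaximalᵤ (((Z ─ ⁅ z ⁆) ∪ ⁅ a ⁆) ∪ ⁅ d ⁆)
  exchange-coverMaximal {Z} {z} {y₀} {a} {d} maximal z∈Z edge₀ a≁d a≁Z d≁Z Y Y⊆O covers
    with covers (x∈p∪q⁺ (inj₁ (x∈p∪q⁺ (inj₂ (x∈⁅x⁆ a))))) | covers (x∈p∪q⁺ (inj₂ (x∈⁅x⁆ d)))
  ... | yₐ , yₐ∈Y , edgeₐ | y_d , y_d∈Y , edge_d = begin
    ∣ ((Z ─ ⁅ z ⁆) ∪ ⁅ a ⁆) ∪ ⁅ d ⁆ ∣   ≤⟨ ∣p∪⁅x⁆∣≤1+∣p∣ ((Z ─ ⁅ z ⁆) ∪ ⁅ a ⁆) d ⟩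
    suc ∣ (Z ─ ⁅ z ⁆) ∪ ⁅ a ⁆ ∣         ≤⟨ s≤s (∣p∪⁅x⁆∣≤1+∣p∣ (Z ─ ⁅ z ⁆) a) ⟩
    suc (suc ∣ Z ─ ⁅ z ⁆ ∣)             ≤⟨ s≤s (x∈p⇒∣p-x∣<∣p∣ z∈Z) ⟩
    suc ∣ Z ∣                           ≤⟨ s≤s (maximal Y′ Y′⊆O coversZ) ⟩
    suc ∣ Y′ ∣                          ≤⟨ s≤s (∣p∪⁅x⁆∣≤1+∣p∣ (Y ─ ⁅ yₐ ⁆ ─ ⁅ y_d ⁆) y₀) ⟩
    suc (suc ∣ Y ─ ⁅ yₐ ⁆ ─ ⁅ y_d ⁆ ∣)  ≤⟨ s≤s (x∈p⇒∣p-x∣<∣p∣ y_d∈Y-yₐ) ⟩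
    suc ∣ Y ─ ⁅ yₐ ⁆ ∣                  ≤⟨ x∈p⇒∣p-x∣<∣p∣ yₐ∈Y ⟩
    ∣ Y ∣                               ∎
    where
    open ≤-Reasoning
    Y′ : Subset n
    Y′ = (Y ─ ⁅ yₐ ⁆ ─ ⁅ y_d ⁆) ∪ ⁅ y₀ ⁆

    y_d∈Y-yₐ : y_d ∈ Y ─ ⁅ yₐ ⁆
    y_d∈Y-yₐ = x∈p∧x≢y⇒x∈p-y y_d∈Y (λ { refl → a≁d (yₐ , edgeₐ , edge_d) })

    Y′⊆O : Y′ ⊆ O
    Y′⊆O y∈Y′ with x∈p∪q⁻ _ _ y∈Y′
    ... | inj₁ y∈ = Y⊆O (p─q⊆p Y _ (p─q⊆p _ _ y∈))
    ... | inj₂ y∈⁅y₀⁆ rewrite x∈⁅y⁆⇒x≡y y₀ y∈⁅y₀⁆ = proj₁ (proj₂ edge₀)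

    coversZ : Coversᵤ Y′ Z
    coversZ {z′} z′∈Z with z′ ≟ z
    ... | yes refl = y₀ , x∈p∪q⁺ (inj₂ (x∈⁅x⁆ y₀)) , edge₀
    ... | no z′≢z with covers (x∈p∪q⁺ (inj₁ (x∈p∪q⁺ (inj₁ (x∈p∧x≢y⇒x∈p-y z′∈Z z′≢z)))))
    ... | y , y∈Y , edge =
      y , x∈p∪q⁺ (inj₁ (x∈p∧x≢y⇒x∈p-y (x∈p∧x≢y⇒x∈p-y y∈Y y≢yₐ) y≢y_d)) , edge
      where
      y≢yₐ : y ≢ yₐ
      y≢yₐ refl = a≁Z z′∈Z z′≢z (y , edgeₐ , edge)
      y≢y_d : y ≢ y_d
      y≢y_d refl = d≁Z z′∈Z z′≢z (y , edge_d , edge)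

-- The four "candidates" of x: the only elements other than x itself that can
-- share a u-neighbour with x.
module Conflicts {n : ℕ} {_+_ : Fin n → Fin n → Fin n} {ε : Fin n} { -_ : Fin n → Fin n}
                 (isAbelianGroup : IsAbelianGroup _≡_ _+_ ε -_) (u : Fin n) where

  open Identities isAbelianGroup
  open IsAbelianGroup isAbelianGroup using (comm)

  w : Fin n
  w = u + u

  cand : Fin n → Fin 4 → Fin n
  cand x 0F = - x
  cand x 1F = w − x
  cand x 2F = x + w
  cand x 3F = x − w

  Link : Fin n → Fin n → Set
  Link x y = (u + y ≡ x) ⊎ (u − y ≡ x) ⊎ (y − u ≡ x)

  -- With t = y − u, the vertex y is a neighbour of u in G_x exactly for x ∈ {t + w, -t, t}.
  OffsetImage : Fin n → Fin n → Set
  OffsetImage t x = x ≡ t + w ⊎ x ≡ - t ⊎ x ≡ t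

  link⇒offsetImage : ∀ {x y} → Link x y → OffsetImage (y − u) x
  link⇒offsetImage {y = y} (inj₁ eq)        = inj₁ (trans (sym eq) (sym (sub-add-double u y)))
  link⇒offsetImage {y = y} (inj₂ (inj₁ eq)) = inj₂ (inj₁ (trans (sym eq) (sym (⁻¹-anti-homo‿- y u))))
  link⇒offsetImage         (inj₂ (inj₂ eq)) = inj₂ (inj₂ (sym eq))

  offsetImage-candidate : ∀ {t x x′} → OffsetImage t x → OffsetImage t x′ →
                          x′ ≡ x ⊎ ∃[ j ] cand x j ≡ x′
  offsetImage-candidate {t} (inj₁ refl) (inj₁ refl)               = inj₁ refl
  offsetImage-candidate {t} (inj₁ refl) (inj₂ (inj₁ refl))        = inj₂ (1F , sub-sum t w)
  offsetImage-candidate {t} (inj₁ refl) (inj₂ (inj₂ refl))        = inj₂ (3F , +-−-cancel w t)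
  offsetImage-candidate {t} (inj₂ (inj₁ refl)) (inj₁ refl)        = inj₂ (1F , sub-neg t w)
  offsetImage-candidate {t} (inj₂ (inj₁ refl)) (inj₂ (inj₁ refl)) = inj₁ refl
  offsetImage-candidate {t} (inj₂ (inj₁ refl)) (inj₂ (inj₂ refl)) = inj₂ (0F , ⁻¹-involutive t)
  offsetImage-candidate {t} (inj₂ (inj₂ refl)) (inj₁ refl)        = inj₂ (2F , refl)
  offsetImage-candidate {t} (inj₂ (inj₂ refl)) (inj₂ (inj₁ refl)) = inj₂ (0F , refl)
  offsetImage-candidate {t} (inj₂ (inj₂ refl)) (inj₂ (inj₂ refl)) = inj₁ refl

  common-neighbour : ∀ {x x′ y} → Link x y → Link x′ y → x′ ≡ x ⊎ ∃[ j ] cand x j ≡ x′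
  common-neighbour l l′ = offsetImage-candidate (link⇒offsetImage l) (link⇒offsetImage l′)

  cand-sym : ∀ {z x} j → cand z j ≡ x → ∃[ k ] cand x k ≡ z
  cand-sym {z} 0F refl = 0F , ⁻¹-involutive z
  cand-sym {z} 1F refl = 1F , sub-sub z w
  cand-sym {z} 2F refl = 3F , +-−-cancel w z
  cand-sym {z} 3F refl = 2F , −-+-cancel w z

  cand₀-cand₃ : ∀ z j → cand (cand z 0F) j ≡ cand z 3F →
    cand z 3F ≡ z ⊎ cand z 3F ≡ cand z 1F ⊎ cand z 3F ≡ cand z 2F ⊎ cand z 0F ≡ z
  cand₀-cand₃ z 0F eq = inj₁ (trans (sym eq) (⁻¹-involutive z))
  cand₀-cand₃ z 1F eq = inj₂ (inj₂ (inj₁ (trans (sym eq) (sub-neg z w))))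
  cand₀-cand₃ z 2F eq = inj₂ (inj₁ (trans (sym eq) (comm (- z) w)))
  cand₀-cand₃ z 3F eq = inj₂ (inj₂ (inj₂ (∙-cancelʳ (- w) (- z) z eq)))

-- The roles a slot can play in the encoding of a pair of preimages, and the
-- codes it may then carry.  A code is a pair of bits, one for each preimage.
module Roles where

  open Counting

  -- For a slot of z ∈ Z holding x: silent slots record nothing; a primary slot
  -- (z is the primary candidate of x) records x's bit of the first preimage;
  -- a secondary slot (z is another candidate of x) records its bit of the
  -- second preimage; an exclusive slot (z is the only candidate) records both.
  data Role : Set where
    silent exclusive primary secondary : Role

  Code : Set
  Code = Bool × Bool

  firstBit : Role → Bool → Bool
  firstBit exclusive b = b
  firstBit primary   b = b
  firstBit _         _ = false

  secondBit : Role → Bool → Bool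
  secondBit exclusive b = b
  secondBit secondary b = b
  secondBit _         _ = false

  slotCode : Role → Bool → Bool → Code
  slotCode r b₁ b₂ = firstBit r b₁ , secondBit r b₂

  allCodes : List Code
  allCodes = (false , false) ∷ (false , true) ∷ (true , false) ∷ (true , true) ∷ []

  slotOptions : Role → List Code
  slotOptions silent    = (false , false) ∷ []
  slotOptions exclusive = allCodes
  slotOptions primary   = (false , false) ∷ (true , false) ∷ []
  slotOptions secondary = (false , false) ∷ (false , true) ∷ []

  slotCode-∈ : ∀ r b₁ b₂ → slotCode r b₁ b₂ ∈ₗ slotOptions r
  slotCode-∈ silent    _     _     = here refl
  slotCode-∈ exclusive false false = here refl
  slotCode-∈ exclusive false true  = there (here refl)
  slotCode-∈ exclusive true  false = there (there (here refl))
  slotCode-∈ exclusive true  true  = there (there (there (here refl)))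
  slotCode-∈ primary   false _     = here refl
  slotCode-∈ primary   true  _     = there (here refl)
  slotCode-∈ secondary _     false = here refl
  slotCode-∈ secondary _     true  = there (here refl)

  length-slotOptions : ∀ r → length (slotOptions r) ≤ 4
  length-slotOptions silent    = s≤s z≤n
  length-slotOptions exclusive = ≤-refl
  length-slotOptions primary   = s≤s (s≤s z≤n)
  length-slotOptions secondary = s≤s (s≤s z≤n)

  isExclusive : Role → Bool
  isExclusive exclusive = true
  isExclusive _         = false

  slotCode-exclusive : ∀ {r} b₁ b₂ → T (isExclusive r) → slotCode r b₁ b₂ ≡ (b₁ , b₂)
  slotCode-exclusive {exclusive} _ _ _ = refl

  -- Two codes are disjoint when no preimage has both bits set.
  Disjoint : Code → Code → Set
  Disjoint (b₁ , b₂) (c₁ , c₂) = b₁ ∧ c₁ ≡ false × b₂ ∧ c₂ ≡ false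

  Admissible : Role → Role → Code × Code → Set
  Admissible r s (c , c′) = T (isExclusive r) → T (isExclusive s) → Disjoint c c′

  admissible? : ∀ r s → Decidable (Admissible r s)
  admissible? r s ((b₁ , b₂) , (c₁ , c₂)) =
    T? (isExclusive r) →-dec T? (isExclusive s) →-dec ((b₁ ∧ c₁ ≟ᵇ false) ×-dec (b₂ ∧ c₂ ≟ᵇ false))

  endOptions : Role → Role → List (Code × Code)
  endOptions r s = filter (admissible? r s) (cartesianProduct (slotOptions r) (slotOptions s))

  endCode-∈ : ∀ r s {b₁ b₂ c₁ c₂} →
    (T (isExclusive r) → T (isExclusive s) → Disjoint (b₁ , b₂) (c₁ , c₂)) →
    (slotCode r b₁ b₂ , slotCode s c₁ c₂) ∈ₗ endOptions r s
  endCode-∈ r s {b₁} {b₂} {c₁} {c₂} disjoint =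
    ∈-filter⁺ (admissible? r s) (∈-cartesianProduct⁺ (slotCode-∈ r b₁ b₂) (slotCode-∈ s c₁ c₂))
      (λ excl-r excl-s → subst₂ Disjoint (sym (slotCode-exclusive b₁ b₂ excl-r))
                                         (sym (slotCode-exclusive c₁ c₂ excl-s)) (disjoint excl-r excl-s))

  private
    endOptions-≤ : ∀ r s → length (endOptions r s) ≤ length (slotOptions r) * length (slotOptions s)
    endOptions-≤ r s = ≤-trans (length-filter (admissible? r s) products)
                               (≤-reflexive (length-cartesianProduct (slotOptions r) (slotOptions s)))
      where
      products : List (Code × Code)
      products = cartesianProduct (slotOptions r) (slotOptions s)

    narrowˡ : ∀ r s → length (slotOptions r) ≤ 2 → length (endOptions r s) ≤ 9
    narrowˡ r s r≤2 = ≤-trans (endOptions-≤ r s) (≤-trans (*-mono-≤ r≤2 (length-slotOptions s)) (n≤1+n 8))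

    narrowʳ : ∀ r s → length (slotOptions s) ≤ 2 → length (endOptions r s) ≤ 9
    narrowʳ r s s≤2 = ≤-trans (endOptions-≤ r s) (≤-trans (*-mono-≤ (length-slotOptions r) s≤2) (n≤1+n 8))

  -- Two end slots have at most 9 joint codes: 3 × 3 disjoint ones if both are
  -- exclusive, and otherwise at most 2 × 4, as one of them has at most two options.
  length-endOptions : ∀ r s → length (endOptions r s) ≤ 9
  length-endOptions silent    s         = narrowˡ silent s (s≤s z≤n)
  length-endOptions primary   s         = narrowˡ primary s ≤-refl
  length-endOptions secondary s         = narrowˡ secondary s ≤-refl
  length-endOptions exclusive silent    = narrowʳ exclusive silent (s≤s z≤n)
  length-endOptions exclusive primary   = narrowʳ exclusive primary ≤-refl
  length-endOptions exclusive secondary = narrowʳ exclusive secondary ≤-refl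
  length-endOptions exclusive exclusive = ≤-refl

  -- The role of a slot holding x, computed from four tests: is x ∈ Z, is this
  -- the first slot holding x, is the slot's owner the primary candidate of x
  -- in Z, and is it the only candidate of x in Z.
  classify : (inZ first isPrimary isSole : Bool) → Role
  classify true  _     _     _     = silent
  classify false false _     _     = silent
  classify false true  true  true  = exclusive
  classify false true  true  false = primary
  classify false true  false _     = secondary

  firstBit-primarySlot : ∀ s b → firstBit (classify false true true s) b ≡ b
  firstBit-primarySlot true  b = refl
  firstBit-primarySlot false b = refl

  classify-exclusive : ∀ a f p s → T (isExclusive (classify a f p s)) →
                       a ≡ false × f ≡ true × s ≡ true
  classify-exclusive false true true true _ = refl , refl , refl

module Preimages {n : ℕ} {_+_ : Fin n → Fin n → Fin n} {ε : Fin n} { -_ : Fin n → Fin n}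
                 (isAbelianGroup : IsAbelianGroup _≡_ _+_ ε -_)
                 (E : Subset n) (E-subgroup : IsSubgroup _+_ ε -_ E)
                 (u : Fin n) (u∈O : u ∈ ∁ E) (Z : Subset n) (Z⊆E : Z ⊆ E) where

  open Subsets
  open Identities isAbelianGroup
  open Conflicts isAbelianGroup u
  open CoverMaximality _+_ ε -_ (∁ E) u
  open Counting
  open Squares

  Preimage : Subset n → Set
  Preimage Z′ = IsMaxCoverMaximalSubset _+_ ε -_ (∁ E) u Z′ Z

  clash⇒candidate : ∀ {x x′} → Clash x x′ → x′ ≡ x ⊎ ∃[ j ] cand x j ≡ x′
  clash⇒candidate (_ , (_ , _ , _ , link) , (_ , _ , _ , link′)) = common-neighbour link link′

  -- Every element of a preimage outside Z has a candidate in Z: otherwise it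
  -- clashes with no member of Z, and adding it to Z would give a larger
  -- cover-maximal subset.
  candidate-in-Z : ∀ {Z′ x} → Preimage Z′ → x ∈ Z′ → x ∉ Z → ∃[ j ] cand x j ∈ Z
  candidate-in-Z {Z′} {x} (Z⊆Z′ , maximal , largest) x∈Z′ x∉Z with any? (λ j → cand x j ∈? Z)
  ... | yes found = found
  ... | no  none  = contradiction
    (largest (Z ∪ ⁅ x ⁆) (∪⁅⁆-⊆ Z⊆Z′ x∈Z′) (insert-coverMaximal maximal noClash))
    (<⇒≱ (∣p∣<∣p∪⁅x⁆∣ x∉Z))
    where
    noClash : ∀ {z} → z ∈ Z → ¬ Clash x z
    noClash z∈Z clash with clash⇒candidate clash
    ... | inj₁ refl       = x∉Z z∈Z
    ... | inj₂ (j , refl) = none (j , z∈Z)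

  Sole : Fin n → Fin n → Set
  Sole x z = ∀ k → cand x k ∈ Z → cand x k ≡ z

  FirstOccurrence : Fin n → Fin 4 → Set
  FirstOccurrence z j = ∀ (k : Fin′ j) → cand z (inject k) ≢ cand z j

  -- z + u is a u-neighbour in G_z (it lies in O as z ∈ E and u ∉ E), unless -z = z.
  partner-edge : ∀ {z} → z ∈ Z → cand z 0F ≢ z → Edge _+_ ε -_ (∁ E) z u (z + u)
  partner-edge {z} z∈Z -z≢z = u∈O , z+u∈O , u≢z+u , inj₂ (inj₂ (+-−-cancel u z))
    where
    +-closed : ∀ {a b} → a ∈ E → b ∈ E → a + b ∈ E
    +-closed = proj₁ (proj₂ E-subgroup)
    neg-closed : ∀ {a} → a ∈ E → - a ∈ E
    neg-closed = proj₂ (proj₂ E-subgroup)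
    z+u∈O : z + u ∈ ∁ E
    z+u∈O = x∉p⇒x∈∁p λ z+u∈E →
      x∈∁p⇒x∉p u∈O (subst (_∈ E) (xyx⁻¹≈y z u) (+-closed z+u∈E (neg-closed (Z⊆E z∈Z))))
    u≢z+u : u ≢ z + u
    u≢z+u u≡z+u = -z≢z (begin
      - z   ≡⟨ cong -_ z≡ε ⟩
      - ε   ≡⟨ ε⁻¹≈ε ⟩
      ε     ≡⟨ z≡ε ⟨
      z     ∎)
      where
      open ≡-Reasoning
      z≡ε : z ≡ ε
      z≡ε = identityˡ-unique z u (sym u≡z+u)

  -- A preimage never contains both a = -z and d = z - w when these lie outside
  -- Z, have z as their sole candidate in Z, and d differs from the other
  -- candidates of z: exchanging z for a and d would give a larger cover-maximal
  -- subset of the preimage.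
  no-exclusive-pair : ∀ {Z′ z} → Preimage Z′ → z ∈ Z →
    cand z 0F ∉ Z → cand z 3F ∉ Z → Sole (cand z 0F) z → Sole (cand z 3F) z →
    FirstOccurrence z 3F → ¬ (cand z 0F ∈ Z′ × cand z 3F ∈ Z′)
  no-exclusive-pair {Z′} {z} (Z⊆Z′ , maximal , largest) z∈Z a∉Z d∉Z sole-a sole-d first-d (a∈Z′ , d∈Z′) =
    <⇒≱ Z<W (largest W W⊆Z′ (exchange-coverMaximal maximal z∈Z (partner-edge z∈Z a≢z) a≁d
                                                    (avoids a∉Z sole-a) (avoids d∉Z sole-d)))
    where
    a d : Fin n
    a = cand z 0F
    d = cand z 3F
    W : Subset n
    W = ((Z ─ ⁅ z ⁆) ∪ ⁅ a ⁆) ∪ ⁅ d ⁆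

    a≢z : a ≢ z
    a≢z a≡z = a∉Z (subst (_∈ Z) (sym a≡z) z∈Z)

    avoids : ∀ {x} → x ∉ Z → Sole x z → ∀ {z′} → z′ ∈ Z → z′ ≢ z → ¬ Clash x z′
    avoids x∉Z sole z′∈Z z′≢z clash with clash⇒candidate clash
    ... | inj₁ refl       = x∉Z z′∈Z
    ... | inj₂ (k , refl) = z′≢z (sole k z′∈Z)

    a≁d : ¬ Clash a d
    a≁d clash with clash⇒candidate clash
    ... | inj₁ d≡a = first-d 0F (sym d≡a)
    ... | inj₂ (j , eq) with cand₀-cand₃ z j eq
    ...   | inj₁ d≡z                 = d∉Z (subst (_∈ Z) (sym d≡z) z∈Z)
    ...   | inj₂ (inj₁ d≡b)          = first-d 1F (sym d≡b)
    ...   | inj₂ (inj₂ (inj₁ d≡c))   = first-d 2F (sym d≡c)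
    ...   | inj₂ (inj₂ (inj₂ a≡z))   = a≢z a≡z

    W⊆Z′ : W ⊆ Z′
    W⊆Z′ = ∪⁅⁆-⊆ (∪⁅⁆-⊆ (Z⊆Z′ ∘ p─q⊆p Z ⁅ z ⁆) a∈Z′) d∈Z′

    d∉Z-z+a : d ∉ (Z ─ ⁅ z ⁆) ∪ ⁅ a ⁆
    d∉Z-z+a d∈ with x∈p∪q⁻ (Z ─ ⁅ z ⁆) ⁅ a ⁆ d∈
    ... | inj₁ d∈Z-z = d∉Z (p─q⊆p Z ⁅ z ⁆ d∈Z-z)
    ... | inj₂ d∈⁅a⁆ = first-d 0F (sym (x∈⁅y⁆⇒x≡y a d∈⁅a⁆))

    Z<W : ∣ Z ∣ < ∣ W ∣
    Z<W = begin-strict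
      ∣ Z ∣                      ≤⟨ ∣p∣≤1+∣p-x∣ Z z ⟩
      suc ∣ Z ─ ⁅ z ⁆ ∣          ≤⟨ ∣p∣<∣p∪⁅x⁆∣ (a∉Z ∘ p─q⊆p Z ⁅ z ⁆) ⟩
      ∣ (Z ─ ⁅ z ⁆) ∪ ⁅ a ⁆ ∣    <⟨ ∣p∣<∣p∪⁅x⁆∣ d∉Z-z+a ⟩
      ∣ W ∣                      ∎
      where open ≤-Reasoning

  open Roles

  primaryCandidate : Fin n → Maybe (Fin n)
  primaryCandidate x with any? (λ k → cand x k ∈? Z)
  ... | yes (k , _) = just (cand x k)
  ... | no  _       = nothing

  primaryCandidate-found : ∀ {x} → ∃[ k ] cand x k ∈ Z →
                           ∃[ k ] (cand x k ∈ Z × primaryCandidate x ≡ just (cand x k))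
  primaryCandidate-found {x} found with any? (λ k → cand x k ∈? Z)
  ... | yes (k , k∈Z) = k , k∈Z , refl
  ... | no  none      = contradiction found none

  isPrimary? : ∀ x z → Dec (primaryCandidate x ≡ just z)
  isPrimary? x z = ≡-decₘ _≟_ (primaryCandidate x) (just z)

  sole? : ∀ x z → Dec (Sole x z)
  sole? x z = all? (λ k → (cand x k ∈? Z) →-dec (cand x k ≟ z))

  other-candidate : ∀ {x z} → ¬ Sole x z → ∃[ k ] (cand x k ∈ Z × cand x k ≢ z)
  other-candidate {x} {z} not-sole
    with ¬∀⟶∃¬ 4 _ (λ k → (cand x k ∈? Z) →-dec (cand x k ≟ z)) not-sole
  ... | k , not-imp with cand x k ∈? Z
  ...   | yes k∈Z = k , k∈Z , λ eq → not-imp (λ _ → eq)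
  ...   | no  k∉Z = contradiction (λ k∈Z → contradiction k∈Z k∉Z) not-imp

  firstOccurrence? : ∀ z j → Dec (FirstOccurrence z j)
  firstOccurrence? z j = all? (λ k → ¬? (cand z (inject k) ≟ cand z j))

  first-slot : ∀ {z x} j → cand z j ≡ x → ∃[ i ] (cand z i ≡ x × FirstOccurrence z i)
  first-slot {z} {x} j eq
    with ¬∀⟶∃¬-smallest 4 (λ i → cand z i ≢ x) (λ i → ¬? (cand z i ≟ x)) (λ all≢ → all≢ j eq)
  ... | i , ¬≢ , earlier = i , eqᵢ , λ k → subst (cand z (inject k) ≢_) (sym eqᵢ) (earlier k)
    where
    eqᵢ : cand z i ≡ x
    eqᵢ = decidable-stable (cand z i ≟ x) ¬≢

  slot-of : ∀ {x z} → ∃[ k ] cand x k ≡ z → ∃[ j ] (cand z j ≡ x × FirstOccurrence z j)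
  slot-of (k , eq) with cand-sym k eq
  ... | j , eq′ = first-slot j eq′

  role : Fin n → Fin 4 → Role
  role z j = classify (does (x ∈? Z)) (does (firstOccurrence? z j))
                      (does (isPrimary? x z)) (does (sole? x z))
    where
    x : Fin n
    x = cand z j

  role-live : ∀ {z j} → cand z j ∉ Z → FirstOccurrence z j →
    role z j ≡ classify false true (does (isPrimary? (cand z j) z)) (does (sole? (cand z j) z))
  role-live {z} {j} x∉Z first
    rewrite dec-false (cand z j ∈? Z) x∉Z | dec-true (firstOccurrence? z j) first = refl

  -- What an exclusive slot guarantees: the hypotheses of no-exclusive-pair.
  role-exclusive : ∀ z j → T (isExclusive (role z j)) →
    cand z j ∉ Z × FirstOccurrence z j × Sole (cand z j) z
  role-exclusive z j excl
    with classify-exclusive (does (cand z j ∈? Z)) (does (firstOccurrence? z j)) _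
                            (does (sole? (cand z j) z)) excl
  ... | ∉Z , first , sole = does-false⇒ (cand z j ∈? Z) ∉Z ,
                            does-true⇒ (firstOccurrence? z j) first ,
                            does-true⇒ (sole? (cand z j) z) sole

  Reveals : (Role → Bool → Bool) → Fin n → Fin 4 → Set
  Reveals read z j = ∀ b → read (role z j) b ≡ b

  Revealed : (Role → Bool → Bool) → Set
  Revealed read = ∀ {x} → x ∉ Z → ∃[ k ] cand x k ∈ Z →
                  ∃[ z ] ∃[ j ] (z ∈ Z × cand z j ≡ x × Reveals read z j)

  primary-slot-reveals : ∀ {x z j} → cand z j ≡ x → x ∉ Z → FirstOccurrence z j →
                         primaryCandidate x ≡ just z → Reveals firstBit z j
  primary-slot-reveals {z = z} {j} refl x∉Z first primary≡ b
    rewrite role-live x∉Z first | dec-true (isPrimary? (cand z j) z) primary≡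
    = firstBit-primarySlot _ b

  exclusive-slot-reveals : ∀ {x z j} → cand z j ≡ x → x ∉ Z → FirstOccurrence z j →
                           primaryCandidate x ≡ just z → Sole x z → Reveals secondBit z j
  exclusive-slot-reveals {z = z} {j} refl x∉Z first primary≡ sole b
    rewrite role-live x∉Z first | dec-true (isPrimary? (cand z j) z) primary≡
          | dec-true (sole? (cand z j) z) sole
    = refl

  secondary-slot-reveals : ∀ {x z j} → cand z j ≡ x → x ∉ Z → FirstOccurrence z j →
                           primaryCandidate x ≢ just z → Reveals secondBit z j
  secondary-slot-reveals {z = z} {j} refl x∉Z first not-primary b
    rewrite role-live x∉Z first | dec-false (isPrimary? (cand z j) z) not-primary
    = refl

  first-revealed : Revealed firstBit
  first-revealed {x} x∉Z found with primaryCandidate-found found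
  ... | k , z∈Z , primary≡ with slot-of (k , refl)
  ... | j , holds-x , first =
    cand x k , j , z∈Z , holds-x , primary-slot-reveals holds-x x∉Z first primary≡

  second-revealed : Revealed secondBit
  second-revealed {x} x∉Z found with primaryCandidate-found found
  ... | k , z∈Z , primary≡ with sole? x (cand x k)
  ...   | yes sole with slot-of (k , refl)
  ...     | j , holds-x , first =
    cand x k , j , z∈Z , holds-x , exclusive-slot-reveals holds-x x∉Z first primary≡ sole
  second-revealed {x} x∉Z found | k , z∈Z , primary≡ | no not-sole with other-candidate not-sole
  ...     | k′ , z′∈Z , z′≢z with slot-of (k′ , refl)
  ...       | j , holds-x , first =
    cand x k′ , j , z′∈Z , holds-x ,
    secondary-slot-reveals holds-x x∉Z first
      (λ primary≡′ → z′≢z (just-injective (trans (sym primary≡′) primary≡)))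

  bit : Subset n → Fin n → Bool
  bit A x = does (x ∈? A)

  -- A preimage is determined by the bits that the revealing slots record:
  -- members of Z lie in every preimage, elements without candidate in Z in
  -- none, and every other element sits in a revealing slot.
  decode : ∀ {A A′} (read : Role → Bool → Bool) → Revealed read → Preimage A → Preimage A′ →
    (∀ {z} → z ∈ Z → ∀ j → read (role z j) (bit A (cand z j)) ≡ read (role z j) (bit A′ (cand z j))) →
    A ⊆ A′
  decode {A} {A′} read revealed preimage preimage′ agree {x} x∈A with x ∈? Z
  ... | yes x∈Z = proj₁ preimage′ x∈Z
  ... | no  x∉Z with revealed x∉Z (candidate-in-Z preimage x∈A x∉Z)
  ...   | z , j , z∈Z , refl , reveals = does-true⇒ (cand z j ∈? A′) (begin
    bit A′ (cand z j)                    ≡⟨ reveals _ ⟨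
    read (role z j) (bit A′ (cand z j))  ≡⟨ agree z∈Z j ⟨
    read (role z j) (bit A (cand z j))   ≡⟨ reveals _ ⟩
    bit A (cand z j)                     ≡⟨ dec-true (cand z j ∈? A) x∈A ⟩
    true                                 ∎)
    where open ≡-Reasoning

  Pair : Set
  Pair = Subset n × Subset n

  code : Pair → Fin n → Fin 4 → Code
  code (A , B) z j = slotCode (role z j) (bit A (cand z j)) (bit B (cand z j))

  LocalCode : Set
  LocalCode = (Code × Code) × (Code × Code)

  localCode : Pair → Fin n → LocalCode
  localCode P z = (code P z 0F , code P z 3F) , (code P z 1F , code P z 2F)

  localCode-≡⇒code-≡ : ∀ {P P′ z} → localCode P z ≡ localCode P′ z → ∀ j → code P z j ≡ code P′ z j
  localCode-≡⇒code-≡ eq 0F = cong (proj₁ ∘ proj₁) eq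
  localCode-≡⇒code-≡ eq 1F = cong (proj₁ ∘ proj₂) eq
  localCode-≡⇒code-≡ eq 2F = cong (proj₂ ∘ proj₂) eq
  localCode-≡⇒code-≡ eq 3F = cong (proj₂ ∘ proj₁) eq

  localOptions : Fin n → List LocalCode
  localOptions z = cartesianProduct (endOptions (role z 0F) (role z 3F))
                                    (cartesianProduct (slotOptions (role z 1F)) (slotOptions (role z 2F)))

  -- At most 9 joint codes for the end slots and 4 for each middle slot.
  length-localOptions : ∀ z → length (localOptions z) ≤ 144
  length-localOptions z =
    length-cartesianProduct-≤ (endOptions r₀ r₃) (cartesianProduct (slotOptions r₁) (slotOptions r₂))
      (length-endOptions r₀ r₃)
      (length-cartesianProduct-≤ (slotOptions r₁) (slotOptions r₂) (length-slotOptions r₁) (length-slotOptions r₂))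
    where
    r₀ r₁ r₂ r₃ : Role
    r₀ = role z 0F
    r₁ = role z 1F
    r₂ = role z 2F
    r₃ = role z 3F

  not-both : ∀ {A x y} → ¬ (x ∈ A × y ∈ A) → bit A x ∧ bit A y ≡ false
  not-both {A} {x} {y} neither with x ∈? A | y ∈? A
  ... | yes x∈A | yes y∈A = contradiction (x∈A , y∈A) neither
  ... | yes _   | no  _   = refl
  ... | no  _   | _       = refl

  -- The local code of a pair of preimages is one of the local options; the end
  -- slots are constrained by no-exclusive-pair.
  localCode-∈ : ∀ {A B z} → Preimage A → Preimage B → z ∈ Z → localCode (A , B) z ∈ₗ localOptions z
  localCode-∈ {A} {B} {z} preimageA preimageB z∈Z =
    ∈-cartesianProduct⁺ (endCode-∈ (role z 0F) (role z 3F) disjoint)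
                        (∈-cartesianProduct⁺ (slotCode-∈ (role z 1F) _ _) (slotCode-∈ (role z 2F) _ _))
    where
    disjoint : T (isExclusive (role z 0F)) → T (isExclusive (role z 3F)) →
      Disjoint (bit A (cand z 0F) , bit B (cand z 0F)) (bit A (cand z 3F) , bit B (cand z 3F))
    disjoint excl₀ excl₃ with role-exclusive z 0F excl₀ | role-exclusive z 3F excl₃
    ... | a∉Z , _ , sole-a | d∉Z , first-d , sole-d =
      not-both (no-exclusive-pair preimageA z∈Z a∉Z d∉Z sole-a sole-d first-d) ,
      not-both (no-exclusive-pair preimageB z∈Z a∉Z d∉Z sole-a sole-d first-d)

  encode : Pair → List LocalCode
  encode P = map (localCode P) (elements Z)

  encode-∈ : ∀ {A B} → Preimage A → Preimage B →
             encode (A , B) ∈ₗ choices (map localOptions (elements Z))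
  encode-∈ {A} {B} preimageA preimageB = map-∈-choices (localCode (A , B)) localOptions (elements Z)
    (λ z∈ → localCode-∈ preimageA preimageB (∈-elements⁻ Z z∈))

  encode-injective : ∀ {A B A′ B′} → Preimage A → Preimage B → Preimage A′ → Preimage B′ →
                     encode (A , B) ≡ encode (A′ , B′) → (A , B) ≡ (A′ , B′)
  encode-injective {A} {B} {A′} {B′} preimageA preimageB preimageA′ preimageB′ eq = cong₂ _,_
    (⊆-antisym (decode firstBit first-revealed preimageA preimageA′ agree₁)
               (decode firstBit first-revealed preimageA′ preimageA (λ z∈Z j → sym (agree₁ z∈Z j))))
    (⊆-antisym (decode secondBit second-revealed preimageB preimageB′ agree₂)
               (decode secondBit second-revealed preimageB′ preimageB (λ z∈Z j → sym (agree₂ z∈Z j))))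
    where
    same-code : ∀ {z} → z ∈ Z → ∀ j → code (A , B) z j ≡ code (A′ , B′) z j
    same-code z∈Z = localCode-≡⇒code-≡
      (map-≡⇒≡ (localCode (A , B)) (localCode (A′ , B′)) (elements Z) eq (∈-elements⁺ Z z∈Z))
    agree₁ : ∀ {z} → z ∈ Z → ∀ j →
             firstBit (role z j) (bit A (cand z j)) ≡ firstBit (role z j) (bit A′ (cand z j))
    agree₁ z∈Z j = cong proj₁ (same-code z∈Z j)
    agree₂ : ∀ {z} → z ∈ Z → ∀ j →
             secondBit (role z j) (bit B (cand z j)) ≡ secondBit (role z j) (bit B′ (cand z j))
    agree₂ z∈Z j = cong proj₂ (same-code z∈Z j)

  -- Pairs of distinct preimages inject into the choices of local codes, of
  -- which there are at most 144 ^ |Z| = (12 ^ |Z|)²; hence at most 12 ^ |Z| preimages.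
  preimage-count : ∀ (L : List (Subset n)) → Unique L → (∀ {Z′} → Z′ ∈ₗ L → Preimage Z′) →
                   length L ≤ 12 ^ ∣ Z ∣
  preimage-count L unique preimage = square-≤-cancel (begin
    length L * length L
      ≡⟨ length-cartesianProduct L L ⟨
    length (cartesianProduct L L)
      ≤⟨ injective-encoding encode (cartesianProduct⁺ unique unique) encode-∈′ encode-injective′ ⟩
    length (choices (map localOptions (elements Z)))
      ≤⟨ length-choices-≤ localOptions (elements Z) (λ _ → length-localOptions _) ⟩
    144 ^ length (elements Z)
      ≡⟨ cong (144 ^_) (length-elements Z) ⟩
    144 ^ ∣ Z ∣
      ≡⟨ ^-square 12 ∣ Z ∣ ⟩
    12 ^ ∣ Z ∣ * 12 ^ ∣ Z ∣ ∎)
    where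
    open ≤-Reasoning
    preimages : ∀ {P} → P ∈ₗ cartesianProduct L L → Preimage (proj₁ P) × Preimage (proj₂ P)
    preimages P∈ with ∈-cartesianProduct⁻ L L P∈
    ... | A∈L , B∈L = preimage A∈L , preimage B∈L
    encode-∈′ : ∀ {P} → P ∈ₗ cartesianProduct L L → encode P ∈ₗ choices (map localOptions (elements Z))
    encode-∈′ P∈ = encode-∈ (proj₁ (preimages P∈)) (proj₂ (preimages P∈))
    encode-injective′ : ∀ {P P′} → P ∈ₗ cartesianProduct L L → P′ ∈ₗ cartesianProduct L L →
                        encode P ≡ encode P′ → P ≡ P′
    encode-injective′ P∈ P′∈ = encode-injective (proj₁ (preimages P∈)) (proj₂ (preimages P∈))
                                                (proj₁ (preimages P′∈)) (proj₂ (preimages P′∈))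

lemma4p5 : ∀ (n : ℕ) (_+_ : Fin n → Fin n → Fin n) (ε : Fin n) (-_ : Fin n → Fin n)
           → IsAbelianGroup _≡_ _+_ ε -_
           → (E : Subset n) → IsSubgroup _+_ ε -_ E → HasIndex2 _+_ ε -_ E
           → (u : Fin n) → u ∈ ∁ E
           → (g : Subset n → Subset n)
           → (∀ (Z : Subset n) → Z ⊆ E → Nonempty Z
                → IsMaxCoverMaximalSubset _+_ ε -_ (∁ E) u Z (g Z))
           → ∀ (Z : Subset n) → Z ⊆ E
           → ∀ (L : List (Subset n)) → Unique L
           → All (λ Z′ → Z′ ⊆ E × Nonempty Z′ × g Z′ ≡ Z) L
           → length L ≤ 12 ^ ∣ Z ∣
lemma4p5 n _+_ ε -_ isAbelianGroup E E-subgroup _ u u∈O g g-maximum Z Z⊆E L unique gL≡Z =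
  preimage-count L unique preimage
  where
  open Preimages isAbelianGroup E E-subgroup u u∈O Z Z⊆E using (Preimage; preimage-count)
  preimage : ∀ {Z′} → Z′ ∈ₗ L → Preimage Z′
  preimage Z′∈L with All.lookup gL≡Z Z′∈L
  ... | Z′⊆E , nonempty , gZ′≡Z =
    subst (IsMaxCoverMaximalSubset _+_ ε -_ (∁ E) u _) gZ′≡Z (g-maximum _ Z′⊆E nonempty)
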